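{- Consider the Round-Robin protocol with $n$ agents over a finite item set $M$, as described in the context. Let agent $i$ have a normalized, nonnegative, monotone submodular objective $f_i$ and a $p_i$-system constraint $\mathcal{I}_i$, and suppose agent $i$ follows the greedy policy, ending with the set $S_i=\{x^i_1,\dots,x^i_s\}$, where $x^i_r$ is the $r$-th item added to $S_i$, and let $S_i^{(r)}=\{x^i_1,\dots,x^i_{r-1}\}$. Let $O_i^-$ be a set with $O_i^-\in\mathcal{I}_i$, $O_i^-\subseteq M_i$ and $f_i(O_i^-)=\mathrm{OPT}^-_i$. Then there is a mapping $\delta: O_i^-\setminus S_i\to S_i$ such that for all $r\in[s]$ and all $x\in O_i^-\setminus S_i$: (1) if $\delta(x)=x^i_r$ then $f_i(x\,|\,S_i^{(r)})\le f_i(x^i_r\,|\,S_i^{(r)})$; and (2) $|\delta^{ -1}(x^i_r)|\le n+p_i-1$.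
   Context: Items: a finite set $M$ with $|M|=m$; agents $[n]$. For $f:2^M\to\mathbb{R}$ write $f(T\,|\,S)=f(T\cup S)-f(S)$, $f(x\,|\,S)=f(\{x\}\,|\,S)$. An independence system is a family $\mathcal{I}\subseteq 2^M$ containing $\emptyset$ and closed under subsets; a basis of $S$ is a maximal member of $\mathcal{I}$ contained in $S$; $\mathrm{ur}(S)$, $\mathrm{lr}(S)$ are the largest and smallest basis cardinalities of $S$; a $p$-system is an independence system with $\max_{S\subseteq M}\mathrm{ur}(S)/\mathrm{lr}(S)\le p$. Round-Robin protocol: initially the available set is $Q=M$; for rounds $r=1,\dots,\lceil m/n\rceil$ and within each round for agents $1,\dots,n$ in order, the current agent (by an arbitrary policy possibly using full information) either selects one item of $Q$, which is removed from $Q$, or selects nothing. Greedy policy of agent $i$: maintain $S_i$ (initially $\emptyset$); at each turn let $A=\{x\in Q: S_i\cup\{x\}\in\mathcal{I}_i\}$; if $A\neq\emptyset$ select some $j\in\arg\max_{x\in A}f_i(x\,|\,S_i)$ and add it to $S_i$, otherwise select nothing. $M_i$ is the set of items still available right before agent $i$'s first turn, and $\mathrm{OPT}^-_i=\max\{f_i(S):S\in\mathcal{I}_i, S\subseteq M_i\}$. -}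

module Defs where

open import Level using (0ℓ)
open import Data.Bool using (Bool; true; false; _∧_; not)
open import Data.Nat using (ℕ; zero; suc; _+_; _*_; _∸_; _≡ᵇ_)
open import Data.Nat.DivMod using (_/_)
open import Data.Maybe using (Maybe; just; nothing)
open import Data.Fin using (Fin; toℕ)
open import Data.Fin.Subset using (Subset; ⊥; ⁅_⁆; _∪_; _∩_; _⊆_; _∈_; _∉_; ∣_∣)
open import Data.Vec using (tabulate; lookup)
open import Data.Product using (_×_; Σ)
open import Relation.Binary.PropositionalEquality using (_≡_)
open import Relation.Nullary using (¬_)
import Data.Nat
open import Relation.Binary.Structures using (IsTotalOrder)
open import Algebra.Structures using (IsAbelianGroup)

-- Values: an arbitrary (totally) ordered abelian group (ℝ is an instance).

record OrderedAbelianGroup : Set₁ where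
  infixl 6 _+ᵥ_
  infix 4 _≤ᵥ_
  field
    Carrier        : Set
    _+ᵥ_           : Carrier → Carrier → Carrier
    0ᵥ             : Carrier
    -ᵥ_            : Carrier → Carrier
    _≤ᵥ_           : Carrier → Carrier → Set
    isAbelianGroup : IsAbelianGroup _≡_ _+ᵥ_ 0ᵥ -ᵥ_
    isTotalOrder   : IsTotalOrder _≡_ _≤ᵥ_
    +-mono-≤       : ∀ {x y} z → x ≤ᵥ y → x +ᵥ z ≤ᵥ y +ᵥ z

  _-ᵥ_ : Carrier → Carrier → Carrier
  x -ᵥ y = x +ᵥ (-ᵥ y)

module _ (V : OrderedAbelianGroup) {m : ℕ} where
  open OrderedAbelianGroup V

  marg : (Subset m → Carrier) → Subset m → Subset m → Carrier
  marg f T S = f (T ∪ S) -ᵥ f S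

  margₑ : (Subset m → Carrier) → Fin m → Subset m → Carrier
  margₑ f x S = marg f ⁅ x ⁆ S

  Normalized : (Subset m → Carrier) → Set
  Normalized f = f ⊥ ≡ 0ᵥ

  NonNegative : (Subset m → Carrier) → Set
  NonNegative f = ∀ S → 0ᵥ ≤ᵥ f S

  Monotone : (Subset m → Carrier) → Set
  Monotone f = ∀ S T → S ⊆ T → f S ≤ᵥ f T

  Submodular : (Subset m → Carrier) → Set
  Submodular f = ∀ S T → f (S ∪ T) +ᵥ f (S ∩ T) ≤ᵥ f S +ᵥ f T

Family : ℕ → Set
Family m = Subset m → Bool

Indep : ∀ {m} → Family m → Subset m → Set
Indep 𝓘 S = 𝓘 S ≡ true

IsIndependenceSystem : ∀ {m} → Family m → Set
IsIndependenceSystem 𝓘 = Indep 𝓘 ⊥ × (∀ A B → A ⊆ B → Indep 𝓘 B → Indep 𝓘 A)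

IsBasis : ∀ {m} → Family m → Subset m → Subset m → Set
IsBasis 𝓘 S B = Indep 𝓘 B × B ⊆ S
  × (∀ B' → Indep 𝓘 B' → B' ⊆ S → B ⊆ B' → B' ≡ B)

-- p-system: max_S ur(S)/lr(S) ≤ p, i.e. every basis of S has size at most
-- p times the size of every basis of S.
IsPSystem : ∀ {m} → ℕ → Family m → Set
IsPSystem p 𝓘 = IsIndependenceSystem 𝓘
  × (∀ S B₁ B₂ → IsBasis 𝓘 S B₁ → IsBasis 𝓘 S B₂ → ∣ B₁ ∣ Data.Nat.≤ p * ∣ B₂ ∣)

-- An execution is described by the sequence of
-- choices c t at the (0-based) global turns t = 0,1,2,...; in round r
-- (0-based) agent j : Fin n plays at turn r * n + toℕ j.

Choices : ℕ → Set
Choices m = ℕ → Maybe (Fin m)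

-- ⌈ m / n ⌉ (with the irrelevant convention ⌈ m / 0 ⌉ = 0)
ceilDiv : ℕ → ℕ → ℕ
ceilDiv m zero    = 0
ceilDiv m (suc k) = (m + k) / suc k

rounds : ℕ → ℕ → ℕ
rounds m n = ceilDiv m n

turn : ∀ {n} → Fin n → ℕ → ℕ
turn {n} j r = r * n + toℕ j

addPick : ∀ {m} → Subset m → Maybe (Fin m) → Subset m
addPick S nothing  = S
addPick S (just x) = S ∪ ⁅ x ⁆

-- items selected at global turns < t (so ∁ (taken c t) is the available set Q)
taken : ∀ {m} → Choices m → ℕ → Subset m
taken c zero    = ⊥
taken c (suc t) = addPick (taken c t) (c t)

-- items selected by agent j in its turns of rounds < r
owned : ∀ {m n} → Choices m → Fin n → ℕ → Subset m
owned c j zero    = ⊥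
owned c j (suc r) = addPick (owned c j r) (c (turn j r))

ValidRun : ∀ {m} → ℕ → Choices m → Set
ValidRun {m} n c = ∀ t → t Data.Nat.< rounds m n * n → ∀ x → c t ≡ just x → x ∉ taken c t

module _ (V : OrderedAbelianGroup) where
  open OrderedAbelianGroup V

  Addable : ∀ {m n} → Family m → Choices m → Fin n → ℕ → Fin m → Set
  Addable 𝓘 c i r x = x ∉ taken c (turn i r) × Indep 𝓘 (owned c i r ∪ ⁅ x ⁆)

  Greedy : ∀ {m} (n : ℕ) → Fin n → (Subset m → Carrier) → Family m → Choices m → Set
  Greedy {m} n i f 𝓘 c = ∀ r → r Data.Nat.< rounds m n →
      (c (turn i r) ≡ nothing → ∀ x → ¬ Addable 𝓘 c i r x)
    × (∀ j → c (turn i r) ≡ just j →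
         Addable 𝓘 c i r j
         × (∀ x → Addable 𝓘 c i r x → margₑ V f x (owned c i r) ≤ᵥ margₑ V f j (owned c i r)))

preimageSize : ∀ {m} → Subset m → Subset m → (Fin m → ℕ) → ℕ → ℕ
preimageSize O S δ r = ∣ tabulate (λ x → lookup O x ∧ not (lookup S x) ∧ (δ x ≡ᵇ r)) ∣

{-# OPTIONS --safe #-}
-- Let the deadline of x ∈ O⁻ ∖ S be the first round in which x is no longer addable for the
-- greedy agent i (already taken, or S⁽ʳ⁾ + x dependent).  Before agent i's turn in round r the
-- other agents have taken at most (n − 1) r items since i's first turn, and the items of O⁻ that
-- cannot extend S⁽ʳ⁾ number at most p r, since S⁽ʳ⁾ is a basis of its union with them.  So at most
-- (n + p − 1) r items of O⁻ ∖ S have deadline ≤ r.  This Hall-type condition lets us schedule the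
-- items in order of deadline, n + p − 1 per round, each strictly before its deadline; in that round
-- x was still addable, so the greedy choice has marginal value at least that of x.
module Submission where

open import Defs

open import Level using (Level)
open import Data.Bool using (Bool; true; T; _∧_; not)
open import Data.Bool.Properties using (T-≡; T-∧; T-not-≡) renaming (_≟_ to _≟ᵇ_)
open import Data.Empty using (⊥-elim)
open import Data.Fin using (Fin; toℕ)
open import Data.Fin.Properties using (any?; toℕ<n; toℕ-injective) renaming (_≟_ to _≟ᶠ_)
open import Data.Fin.Subset
open import Data.Fin.Subset.Induction using (⊃-wellFounded)
open import Data.Fin.Subset.Properties
open import Data.Maybe using (just; nothing)
open import Data.Nat
  using (ℕ; zero; suc; _+_; _*_; _∸_; _≤_; _<_; _≤′_; _≤?_; _<?_; _≡ᵇ_; z≤n; s≤s; s≤s⁻¹; ≤′-refl; ≤′-step)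
open import Data.Nat.DivMod using (_/_; _%_; m≡m%n+[m/n]*n; m%n<n; m<n*o⇒m/o<n)
open import Data.Nat.Properties
open import Data.Product using (Σ; ∃; _×_; _,_; proj₁; proj₂)
open import Data.Sum using (inj₁; inj₂)
open import Data.Vec using (_∷_; []; tabulate; lookup; there)
open import Data.Vec.Properties using (lookup∘tabulate; []=⇒lookup; lookup⇒[]=)
open import Function using (id; _∘_; _⇔_; mk⇔; Equivalence)
open import Induction.WellFounded using (Acc; acc)
open import Relation.Binary.Definitions using (tri<; tri≈; tri>)
open import Relation.Binary.PropositionalEquality
open import Relation.Nullary using (¬_; Dec; yes; no; contradiction)
open import Relation.Nullary.Decidable using (_×-dec_; ¬?; isYes; toWitness; fromWitness)
open import Relation.Unary using (Pred; Decidable)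

private
  variable
    ℓ : Level
    n : ℕ
    x : Fin n
    p q : Subset n

-- Counting subsets of Fin n

x∈p─q⁻ : ∀ (p q : Subset n) → x ∈ p ─ q → x ∈ p × x ∉ q
x∈p─q⁻ p q x∈p─q = p─q⊆p p q x∈p─q , x∉q q x∈p─q
  where
  x∉q : ∀ {n x} {p : Subset n} (q : Subset n) → x ∈ p ─ q → x ∉ q
  x∉q {p = _ ∷ p} (_ ∷ q) (there x∈p─q) (there x∈q) = x∉q q x∈p─q x∈q

∪⁅⁆⊆ : p ⊆ q → x ∈ q → p ∪ ⁅ x ⁆ ⊆ q
∪⁅⁆⊆ {p = p} {x = x} p⊆q x∈q y∈ with x∈p∪q⁻ p ⁅ x ⁆ y∈
... | inj₁ y∈p  = p⊆q y∈p
... | inj₂ y∈⁅x⁆ = subst (_∈ _) (sym (x∈⁅y⁆⇒x≡y x y∈⁅x⁆)) x∈q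

∣p∪q∣≤∣p∣+∣q∣ : ∀ (p q : Subset n) → ∣ p ∪ q ∣ ≤ ∣ p ∣ + ∣ q ∣
∣p∪q∣≤∣p∣+∣q∣ []            []            = z≤n
∣p∪q∣≤∣p∣+∣q∣ (outside ∷ p) (outside ∷ q) = ∣p∪q∣≤∣p∣+∣q∣ p q
∣p∪q∣≤∣p∣+∣q∣ (outside ∷ p) (inside  ∷ q) =
  ≤-trans (s≤s (∣p∪q∣≤∣p∣+∣q∣ p q)) (≤-reflexive (sym (+-suc ∣ p ∣ ∣ q ∣)))
∣p∪q∣≤∣p∣+∣q∣ (inside  ∷ p) (s       ∷ q) =
  s≤s (≤-trans (∣p∪q∣≤∣p∣+∣q∣ p q) (+-monoʳ-≤ ∣ p ∣ (∣p∣≤∣x∷p∣ s q)))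

∣p∪⁅x⁆∣≤1+∣p∣ : ∀ (p : Subset n) x → ∣ p ∪ ⁅ x ⁆ ∣ ≤ suc ∣ p ∣
∣p∪⁅x⁆∣≤1+∣p∣ p x = begin
  ∣ p ∪ ⁅ x ⁆ ∣       ≤⟨ ∣p∪q∣≤∣p∣+∣q∣ p ⁅ x ⁆ ⟩
  ∣ p ∣ + ∣ ⁅ x ⁆ ∣   ≡⟨ cong (∣ p ∣ +_) (∣⁅x⁆∣≡1 x) ⟩
  ∣ p ∣ + 1         ≡⟨ +-comm ∣ p ∣ 1 ⟩
  suc ∣ p ∣         ∎
  where open ≤-Reasoning

∣p∣≤1+∣p-x∣ : ∀ (p : Subset n) x → ∣ p ∣ ≤ suc ∣ p - x ∣
∣p∣≤1+∣p-x∣ p x = ≤-trans (p⊆q⇒∣p∣≤∣q∣ p⊆[p-x]∪⁅x⁆) (∣p∪⁅x⁆∣≤1+∣p∣ (p - x) x)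
  where
  p⊆[p-x]∪⁅x⁆ : p ⊆ (p - x) ∪ ⁅ x ⁆
  p⊆[p-x]∪⁅x⁆ {y} y∈p with y ≟ᶠ x
  ... | yes refl = x∈p∪q⁺ (inj₂ (x∈⁅x⁆ x))
  ... | no  y≢x  = x∈p∪q⁺ (inj₁ (x∈p∧x≢y⇒x∈p-y y∈p y≢x))

Empty⇒∣p∣≡0 : Empty p → ∣ p ∣ ≡ 0
Empty⇒∣p∣≡0 {n} empty = trans (cong ∣_∣ (Empty-unique empty)) (∣⊥∣≡0 n)

x∈p⇒0<∣p∣ : x ∈ p → 0 < ∣ p ∣
x∈p⇒0<∣p∣ x∈p = ≤-<-trans z≤n (x∈p⇒∣p-x∣<∣p∣ x∈p)

injective⇒∣p∣≤ : ∀ (p : Subset n) (g : Fin n → ℕ) {k} →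
                 (∀ {x} → x ∈ p → g x < k) →
                 (∀ {x y} → x ∈ p → y ∈ p → g x ≡ g y → x ≡ y) →
                 ∣ p ∣ ≤ k
injective⇒∣p∣≤ p g {zero} g<0 _ = ≤-reflexive (Empty⇒∣p∣≡0 λ (_ , x∈p) → n≮0 (g<0 x∈p))
injective⇒∣p∣≤ p g {suc k} g<1+k injective with any? (λ x → x ∈? p ×-dec g x ≟ k)
... | yes (x , x∈p , gx≡k) =
  ≤-trans (∣p∣≤1+∣p-x∣ p x) (s≤s (injective⇒∣p∣≤ (p - x) g g<k injective-p-x))
  where
  g<k : ∀ {y} → y ∈ p - x → g y < k
  g<k y∈p-x with y∈p , y∉⁅x⁆ ← x∈p─q⁻ p ⁅ x ⁆ y∈p-x =
    ≤∧≢⇒< (s≤s⁻¹ (g<1+k y∈p)) λ gy≡k →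
      y∉⁅x⁆ (subst (_∈ ⁅ x ⁆) (injective x∈p y∈p (trans gx≡k (sym gy≡k))) (x∈⁅x⁆ x))
  injective-p-x : ∀ {y z} → y ∈ p - x → z ∈ p - x → g y ≡ g z → y ≡ z
  injective-p-x y∈ z∈ = injective (proj₁ (x∈p─q⁻ p ⁅ x ⁆ y∈)) (proj₁ (x∈p─q⁻ p ⁅ x ⁆ z∈))
... | no ∄x = m≤n⇒m≤1+n (injective⇒∣p∣≤ p g g<k injective)
  where
  g<k : ∀ {y} → y ∈ p → g y < k
  g<k {y} y∈p = ≤∧≢⇒< (s≤s⁻¹ (g<1+k y∈p)) λ gy≡k → ∄x (y , y∈p , gy≡k)

∈⇔T-lookup : x ∈ p ⇔ T (lookup p x)
∈⇔T-lookup {x = x} {p = p} =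
  mk⇔ (Equivalence.from T-≡ ∘ []=⇒lookup) (lookup⇒[]= x p ∘ Equivalence.to T-≡)

∈-tabulate⇔ : ∀ (b : Fin n → Bool) → x ∈ tabulate b ⇔ T (b x)
∈-tabulate⇔ {x = x} b = subst (λ c → x ∈ tabulate b ⇔ T c) (lookup∘tabulate b x) ∈⇔T-lookup

filter : {P : Pred (Fin n) ℓ} → Decidable P → Subset n → Subset n
filter P? p = p ∩ tabulate (isYes ∘ P?)

module _ {P : Pred (Fin n) ℓ} (P? : Decidable P) where

  ∈-filter⁺ : x ∈ p → P x → x ∈ filter P? p
  ∈-filter⁺ {x} x∈p Px =
    x∈p∩q⁺ (x∈p , Equivalence.from (∈-tabulate⇔ (isYes ∘ P?)) (fromWitness {a? = P? x} Px))

  ∈-filter⁻ : ∀ (p : Subset n) → x ∈ filter P? p → x ∈ p × P x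
  ∈-filter⁻ {x} p x∈ with x∈p , x∈P ← x∈p∩q⁻ p _ x∈ =
    x∈p , toWitness {a? = P? x} (Equivalence.to (∈-tabulate⇔ (isYes ∘ P?)) x∈P)

  filter⊆ : ∀ (p : Subset n) → filter P? p ⊆ p
  filter⊆ p = proj₁ ∘ ∈-filter⁻ p

filter-mono : ∀ {ℓ′} {P : Pred (Fin n) ℓ} {Q : Pred (Fin n) ℓ′}
              (P? : Decidable P) (Q? : Decidable Q) (p : Subset n) →
              (∀ {x} → x ∈ p → P x → Q x) → filter P? p ⊆ filter Q? p
filter-mono P? Q? p P⇒Q x∈ with x∈p , Px ← ∈-filter⁻ P? p x∈ = ∈-filter⁺ Q? x∈p (P⇒Q x∈p Px)

-- Scheduling under a Hall condition

module Rank {m} (X : Subset m) (κ : Fin m → ℕ) where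

  rank : Fin m → ℕ
  rank x = ∣ filter (λ y → κ y <? κ x) X ∣

  rank-mono : ∀ {x y} → y ∈ X → κ y < κ x → rank y < rank x
  rank-mono {x} {y} y∈X κy<κx = p⊂q⇒∣p∣<∣q∣
    ( filter-mono _ _ X (λ _ κz<κy → <-trans κz<κy κy<κx)
    , y , ∈-filter⁺ _ y∈X κy<κx , <-irrefl refl ∘ proj₂ ∘ ∈-filter⁻ _ X )

  rank<∣κ≤∣ : ∀ {x} → x ∈ X → rank x < ∣ filter (λ y → κ y ≤? κ x) X ∣
  rank<∣κ≤∣ {x} x∈X = p⊂q⇒∣p∣<∣q∣
    ( filter-mono _ _ X (λ _ → <⇒≤)
    , x , ∈-filter⁺ _ x∈X ≤-refl , <-irrefl refl ∘ proj₂ ∘ ∈-filter⁻ _ X )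

  rank-injective : (∀ {x y} → κ x ≡ κ y → x ≡ y) →
                   ∀ {x y} → x ∈ X → y ∈ X → rank x ≡ rank y → x ≡ y
  rank-injective κ-injective {x} {y} x∈X y∈X rx≡ry with <-cmp (κ x) (κ y)
  ... | tri< κx<κy _ _ = contradiction rx≡ry (<⇒≢ (rank-mono x∈X κx<κy))
  ... | tri≈ _ κx≡κy _ = κ-injective κx≡κy
  ... | tri> _ _ κy<κx = contradiction (sym rx≡ry) (<⇒≢ (rank-mono y∈X κy<κx))

module LexicographicKey {m} (d : Fin m → ℕ) where

  key : Fin m → ℕ
  key x = d x * m + toℕ x

  key-mono : ∀ {x y} → d y < d x → key y < key x
  key-mono {x} {y} dy<dx = begin-strict
    d y * m + toℕ y  <⟨ +-monoʳ-< (d y * m) (toℕ<n y) ⟩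
    d y * m + m      ≡⟨ +-comm (d y * m) m ⟩
    suc (d y) * m    ≤⟨ *-monoˡ-≤ m dy<dx ⟩
    d x * m          ≤⟨ m≤m+n (d x * m) (toℕ x) ⟩
    key x            ∎
    where open ≤-Reasoning

  key≤⇒d≤ : ∀ {x y} → key y ≤ key x → d y ≤ d x
  key≤⇒d≤ ky≤kx = ≮⇒≥ λ dx<dy → <⇒≱ (key-mono dx<dy) ky≤kx

  key-injective : ∀ {x y} → key x ≡ key y → x ≡ y
  key-injective {x} {y} kx≡ky with <-cmp (d x) (d y)
  ... | tri< dx<dy _ _ = contradiction kx≡ky (<⇒≢ (key-mono dx<dy))
  ... | tri> _ _ dy<dx = contradiction (sym kx≡ky) (<⇒≢ (key-mono dy<dx))
  ... | tri≈ _ dx≡dy _ = toℕ-injective (+-cancelˡ-≡ (d x * m) (toℕ x) (toℕ y)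
                           (trans kx≡ky (cong (λ e → e * m + toℕ y) (sym dx≡dy))))

module _ {m} (X : Subset m) (deadline : Fin m → ℕ) (C : ℕ) where

  HallCondition : Set
  HallCondition = ∀ K → ∣ filter (λ x → deadline x ≤? K) X ∣ ≤ C * K

  record Schedule : Set where
    field
      slot          : Fin m → ℕ
      slot<deadline : ∀ {x} → x ∈ X → slot x < deadline x
      load≤capacity : ∀ r {p} → (∀ {x} → x ∈ p → x ∈ X × slot x ≡ r) → ∣ p ∣ ≤ C

hall⇒schedule : ∀ {m} (X : Subset m) (deadline : Fin m → ℕ) C →
                HallCondition X deadline C → Schedule X deadline C
hall⇒schedule X deadline zero hall = record
  { slot          = λ _ → 0
  ; slot<deadline = ⊥-elim ∘ ∉X
  ; load≤capacity = λ _ p⊆X → ≤-reflexive (Empty⇒∣p∣≡0 λ (_ , x∈p) → ∉X (proj₁ (p⊆X x∈p)))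
  }
  where
  ∉X : ∀ {x} → x ∉ X
  ∉X {x} x∈X = <⇒≱ (x∈p⇒0<∣p∣ (∈-filter⁺ _ x∈X ≤-refl)) (hall (deadline x))
hall⇒schedule {m} X deadline C@(suc _) hall = record
  { slot          = slot
  ; slot<deadline = slot<deadline
  ; load≤capacity = load≤capacity
  }
  where
  open LexicographicKey deadline
  open Rank X key

  -- Sort X by deadline, ties broken by index, and fill the slots C items at a time.
  slot : Fin m → ℕ
  slot x = rank x / C

  slot<deadline : ∀ {x} → x ∈ X → slot x < deadline x
  slot<deadline {x} x∈X = m<n*o⇒m/o<n (begin-strict
    rank x                                         <⟨ rank<∣κ≤∣ x∈X ⟩
    ∣ filter (λ y → key y ≤? key x) X ∣            ≤⟨ p⊆q⇒∣p∣≤∣q∣ key≤⊆deadline≤ ⟩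
    ∣ filter (λ y → deadline y ≤? deadline x) X ∣  ≤⟨ hall (deadline x) ⟩
    C * deadline x                                 ≡⟨ *-comm C (deadline x) ⟩
    deadline x * C                                 ∎)
    where
    open ≤-Reasoning
    key≤⊆deadline≤ : filter (λ y → key y ≤? key x) X ⊆ filter (λ y → deadline y ≤? deadline x) X
    key≤⊆deadline≤ = filter-mono (λ y → key y ≤? key x) (λ y → deadline y ≤? deadline x) X (λ _ → key≤⇒d≤)

  load≤capacity : ∀ r {p} → (∀ {x} → x ∈ p → x ∈ X × slot x ≡ r) → ∣ p ∣ ≤ C
  load≤capacity r {p} p⊆slot⁻¹r =
    injective⇒∣p∣≤ p (λ x → rank x % C) (λ {x} _ → m%n<n (rank x) C) injective
    where
    rank≡ : ∀ {x} → x ∈ p → rank x ≡ rank x % C + r * C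
    rank≡ {x} x∈p = trans (m≡m%n+[m/n]*n (rank x) C)
                          (cong (λ s → rank x % C + s * C) (proj₂ (p⊆slot⁻¹r x∈p)))
    injective : ∀ {x y} → x ∈ p → y ∈ p → rank x % C ≡ rank y % C → x ≡ y
    injective x∈p y∈p ≡% =
      rank-injective key-injective (proj₁ (p⊆slot⁻¹r x∈p)) (proj₁ (p⊆slot⁻¹r y∈p))
        (trans (rank≡ x∈p) (trans (cong (_+ r * C) ≡%) (sym (rank≡ y∈p))))

module _ {P : Pred ℕ ℓ} (P? : Decidable P) where

  prefixLength : ℕ → ℕ
  prefixLength zero    = zero
  prefixLength (suc k) with P? k
  ... | yes _ = suc k
  ... | no  _ = prefixLength k

  prefixLength≤ : ∀ k → prefixLength k ≤ k
  prefixLength≤ zero    = z≤n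
  prefixLength≤ (suc k) with P? k
  ... | yes _ = ≤-refl
  ... | no  _ = m≤n⇒m≤1+n (prefixLength≤ k)

  P⇒<prefixLength : ∀ {j k} → j < k → P j → j < prefixLength k
  P⇒<prefixLength {j} {suc k} j<1+k Pj with P? k
  ... | yes _  = j<1+k
  ... | no ¬Pk with m<1+n⇒m<n∨m≡n j<1+k
  ...   | inj₁ j<k  = P⇒<prefixLength j<k Pj
  ...   | inj₂ refl = contradiction Pj ¬Pk

  <prefixLength⇒P : (∀ {i j} → i ≤ j → P j → P i) → ∀ {j k} → j < prefixLength k → P j
  <prefixLength⇒P antitone {j} {suc k} j<ℓ with P? k
  ... | yes Pk = antitone (s≤s⁻¹ j<ℓ) Pk
  ... | no  _  = <prefixLength⇒P antitone {k = k} j<ℓ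

-- Independence systems

SubsetClosed : ∀ {m} → Family m → Set
SubsetClosed 𝓘 = ∀ A B → A ⊆ B → Indep 𝓘 B → Indep 𝓘 A

module _ {m} {𝓘 : Family m} (closed : SubsetClosed 𝓘) where

  extendToBasis : ∀ {U A} → Indep 𝓘 A → A ⊆ U → ∃ λ B → IsBasis 𝓘 U B × A ⊆ B
  extendToBasis {U} {A} = go A (⊃-wellFounded A)
    where
    go : ∀ A → Acc _⊃_ A → Indep 𝓘 A → A ⊆ U → ∃ λ B → IsBasis 𝓘 U B × A ⊆ B
    go A (acc rec) indepA A⊆U
      with any? (λ y → y ∈? U ×-dec ¬? (y ∈? A) ×-dec 𝓘 (A ∪ ⁅ y ⁆) ≟ᵇ true)
    ... | yes (y , y∈U , y∉A , indepA∪y)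
      with B , basis , A∪y⊆B ← go (A ∪ ⁅ y ⁆) (rec (p⊆p∪q ⁅ y ⁆ , y , x∈p∪q⁺ (inj₂ (x∈⁅x⁆ y)) , y∉A))
                                  indepA∪y (∪⁅⁆⊆ A⊆U y∈U)
      = B , basis , A∪y⊆B ∘ p⊆p∪q ⁅ y ⁆
    ... | no ∄y = A , (indepA , A⊆U , maximal) , id
      where
      maximal : ∀ B → Indep 𝓘 B → B ⊆ U → A ⊆ B → B ≡ A
      maximal B indepB B⊆U A⊆B = ⊆-antisym B⊆A A⊆B
        where
        B⊆A : B ⊆ A
        B⊆A {y} y∈B with y ∈? A
        ... | yes y∈A = y∈A
        ... | no  y∉A = ⊥-elim (∄y (y , B⊆U y∈B , y∉A , closed _ _ (∪⁅⁆⊆ A⊆B y∈B) indepB))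

  nonExtendable⇒isBasis : ∀ {B D} → Indep 𝓘 B → (∀ {x} → x ∈ D → ¬ Indep 𝓘 (B ∪ ⁅ x ⁆)) →
                          IsBasis 𝓘 (B ∪ D) B
  nonExtendable⇒isBasis {B} {D} indepB stuck = indepB , p⊆p∪q D , maximal
    where
    maximal : ∀ B′ → Indep 𝓘 B′ → B′ ⊆ B ∪ D → B ⊆ B′ → B′ ≡ B
    maximal B′ indepB′ B′⊆B∪D B⊆B′ = ⊆-antisym B′⊆B B⊆B′
      where
      B′⊆B : B′ ⊆ B
      B′⊆B y∈B′ with x∈p∪q⁻ B D (B′⊆B∪D y∈B′)
      ... | inj₁ y∈B = y∈B
      ... | inj₂ y∈D = ⊥-elim (stuck y∈D (closed _ _ (∪⁅⁆⊆ B⊆B′ y∈B′) indepB′))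

indep⇒isBasis : ∀ {m} {𝓘 : Family m} {A} → Indep 𝓘 A → IsBasis 𝓘 A A
indep⇒isBasis indepA = indepA , id , λ _ _ B⊆A A⊆B → ⊆-antisym B⊆A A⊆B

∣nonExtendable∣≤p*∣B∣ : ∀ {m p} {𝓘 : Family m} {B D} → IsPSystem p 𝓘 → Indep 𝓘 B → Indep 𝓘 D →
                        (∀ {x} → x ∈ D → ¬ Indep 𝓘 (B ∪ ⁅ x ⁆)) → ∣ D ∣ ≤ p * ∣ B ∣
∣nonExtendable∣≤p*∣B∣ {B = B} {D} ((_ , closed) , bases≤) indepB indepD stuck
  with B₂ , basis₂ , D⊆B₂ ← extendToBasis closed indepD (q⊆p∪q B D) =
  ≤-trans (p⊆q⇒∣p∣≤∣q∣ D⊆B₂) (bases≤ (B ∪ D) B₂ B basis₂ (nonExtendable⇒isBasis closed indepB stuck))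

-- Round-Robin runs

module _ {m} (T : Subset m) where

  addPick-⊇ : ∀ mx → T ⊆ addPick T mx
  addPick-⊇ nothing  = id
  addPick-⊇ (just j) = p⊆p∪q ⁅ j ⁆

  ∈-addPick : ∀ {mx j} → mx ≡ just j → j ∈ addPick T mx
  ∈-addPick {j = j} refl = x∈p∪q⁺ (inj₂ (x∈⁅x⁆ j))

  ∣addPick∣≤ : ∀ mx → ∣ addPick T mx ∣ ≤ suc ∣ T ∣
  ∣addPick∣≤ nothing  = n≤1+n ∣ T ∣
  ∣addPick∣≤ (just j) = ∣p∪⁅x⁆∣≤1+∣p∣ T j

  module _ (U : Subset m) where

    addPick─⊆ : ∀ mx → addPick T mx ─ U ⊆ addPick (T ─ U) mx
    addPick─⊆ nothing  = id
    addPick─⊆ (just j) x∈ with x∈T∪j , x∉U ← x∈p─q⁻ (T ∪ ⁅ j ⁆) U x∈ with x∈p∪q⁻ T ⁅ j ⁆ x∈T∪j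
    ... | inj₁ x∈T = x∈p∪q⁺ (inj₁ (x∈p∧x∉q⇒x∈p─q x∈T x∉U))
    ... | inj₂ x∈j = x∈p∪q⁺ (inj₂ x∈j)

    addPick─⊆-pickIn : ∀ mx → (∀ {j} → mx ≡ just j → j ∈ U) → addPick T mx ─ U ⊆ T ─ U
    addPick─⊆-pickIn nothing  _   = id
    addPick─⊆-pickIn (just j) j∈U x∈ with x∈T∪j , x∉U ← x∈p─q⁻ (T ∪ ⁅ j ⁆) U x∈ with x∈p∪q⁻ T ⁅ j ⁆ x∈T∪j
    ... | inj₁ x∈T = x∈p∧x∉q⇒x∈p─q x∈T x∉U
    ... | inj₂ x∈j = contradiction (subst (_∈ U) (sym (x∈⁅y⁆⇒x≡y j x∈j)) (j∈U refl)) x∉U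

module _ {m} (c : Choices m) where

  taken-mono : ∀ {t t′} → t ≤ t′ → taken c t ⊆ taken c t′
  taken-mono = go ∘ ≤⇒≤′
    where
    go : ∀ {t t′} → t ≤′ t′ → taken c t ⊆ taken c t′
    go ≤′-refl         = id
    go (≤′-step {t′} t≤′t′) = addPick-⊇ (taken c t′) (c t′) ∘ go t≤′t′

  ∣taken∣≤ : ∀ t → ∣ taken c t ∣ ≤ t
  ∣taken∣≤ zero    = ≤-reflexive (∣⊥∣≡0 m)
  ∣taken∣≤ (suc t) = ≤-trans (∣addPick∣≤ (taken c t) (c t)) (s≤s (∣taken∣≤ t))

  ∣taken+─∣≤ : ∀ U d t → ∣ taken c (d + t) ─ U ∣ ≤ d + ∣ taken c t ─ U ∣
  ∣taken+─∣≤ U zero    t = ≤-refl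
  ∣taken+─∣≤ U (suc d) t = begin
    ∣ addPick (taken c (d + t)) (c (d + t)) ─ U ∣ ≤⟨ p⊆q⇒∣p∣≤∣q∣ (addPick─⊆ (taken c (d + t)) U (c (d + t))) ⟩
    ∣ addPick (taken c (d + t) ─ U) (c (d + t)) ∣ ≤⟨ ∣addPick∣≤ (taken c (d + t) ─ U) (c (d + t)) ⟩
    suc ∣ taken c (d + t) ─ U ∣                   ≤⟨ s≤s (∣taken+─∣≤ U d t) ⟩
    suc d + ∣ taken c t ─ U ∣                     ∎
    where open ≤-Reasoning

module _ {m n} (c : Choices m) (i : Fin n) where

  owned≡taken : ∀ r → owned c i r ≡ taken (c ∘ turn i) r
  owned≡taken zero    = refl
  owned≡taken (suc r) = cong (λ T → addPick T (c (turn i r))) (owned≡taken r)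

  owned-mono : ∀ {r s} → r ≤ s → owned c i r ⊆ owned c i s
  owned-mono {r} {s} r≤s rewrite owned≡taken r | owned≡taken s = taken-mono (c ∘ turn i) r≤s

  ∣owned∣≤ : ∀ r → ∣ owned c i r ∣ ≤ r
  ∣owned∣≤ r rewrite owned≡taken r = ∣taken∣≤ (c ∘ turn i) r

turn-mono : ∀ {n} (i : Fin n) {r s} → r ≤ s → turn i r ≤ turn i s
turn-mono {n} i r≤s = +-monoˡ-≤ (toℕ i) (*-monoˡ-≤ n r≤s)

turn-suc : ∀ {n′} (i : Fin (suc n′)) r → turn i (suc r) ≡ n′ + suc (turn i r)
turn-suc {n′} i r = begin
  suc (n′ + r * suc n′) + toℕ i   ≡⟨ cong suc (+-assoc n′ (r * suc n′) (toℕ i)) ⟩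
  suc (n′ + turn i r)             ≡⟨ +-suc n′ (turn i r) ⟨
  n′ + suc (turn i r)             ∎
  where open ≡-Reasoning

m≤rounds*n : ∀ m n′ → m ≤ rounds m (suc n′) * suc n′
m≤rounds*n m n′ = +-cancelˡ-≤ n′ m _ (begin
  n′ + m                                ≡⟨ +-comm n′ m ⟩
  m + n′                                ≡⟨ m≡m%n+[m/n]*n (m + n′) (suc n′) ⟩
  (m + n′) % suc n′ + rounds m (suc n′) * suc n′
                                        ≤⟨ +-monoˡ-≤ _ (s≤s⁻¹ (m%n<n (m + n′) (suc n′))) ⟩
  n′ + rounds m (suc n′) * suc n′       ∎)
  where open ≤-Reasoning

module GreedyRun (V : OrderedAbelianGroup) {m n′} (i : Fin (suc n′))
                 (f : Subset m → OrderedAbelianGroup.Carrier V) (𝓘 : Family m)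
                 (indepSystem : IsIndependenceSystem 𝓘)
                 (c : Choices m) (greedy : Greedy V (suc n′) i f 𝓘 c) where

  open OrderedAbelianGroup V using (_≤ᵥ_)

  R : ℕ
  R = rounds m (suc n′)

  S : Subset m
  S = owned c i R

  closed : SubsetClosed 𝓘
  closed = proj₂ indepSystem

  AddableAt : ℕ → Fin m → Set
  AddableAt = Addable V 𝓘 c i

  addable? : ∀ r x → Dec (AddableAt r x)
  addable? r x = ¬? (x ∈? taken c (turn i r)) ×-dec 𝓘 (owned c i r ∪ ⁅ x ⁆) ≟ᵇ true

  addable-antitone : ∀ {x r s} → r ≤ s → AddableAt s x → AddableAt r x
  addable-antitone {x} r≤s (x∉taken , indep) =
      x∉taken ∘ taken-mono c (turn-mono i r≤s)
    , closed _ _ (∪⁅⁆⊆ (p⊆p∪q ⁅ x ⁆ ∘ owned-mono c i r≤s) (x∈p∪q⁺ (inj₂ (x∈⁅x⁆ x)))) indep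

  greedy-dominates : ∀ {r x} → r < R → AddableAt r x →
                     Σ (Fin m) λ j → c (turn i r) ≡ just j
                       × margₑ V f x (owned c i r) ≤ᵥ margₑ V f j (owned c i r)
  greedy-dominates {r} {x} r<R addable with c (turn i r) | greedy r r<R
  ... | nothing | stuck , _  = ⊥-elim (stuck refl x addable)
  ... | just j  | _ , picked = j , refl , proj₂ (picked j refl) x addable

  owned-indep : ∀ {r} → r ≤ R → Indep 𝓘 (owned c i r)
  owned-indep {zero}  _   = proj₁ indepSystem
  owned-indep {suc r} r<R with c (turn i r) | greedy r r<R
  ... | nothing | _          = owned-indep (<⇒≤ r<R)
  ... | just j  | _ , picked = proj₂ (proj₁ (picked j refl))

  deadline : Fin m → ℕ
  deadline x = prefixLength (λ r → addable? r x) R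

  deadline≤R : ∀ x → deadline x ≤ R
  deadline≤R x = prefixLength≤ (λ r → addable? r x) R

  addable⇒<deadline : ∀ {r x} → r < R → AddableAt r x → r < deadline x
  addable⇒<deadline {x = x} = P⇒<prefixLength (λ r → addable? r x)

  <deadline⇒addable : ∀ {r x} → r < deadline x → AddableAt r x
  <deadline⇒addable {x = x} = <prefixLength⇒P (λ r → addable? r x) addable-antitone {k = R}

  <deadline⇒dominated : ∀ {r x} → r < deadline x →
                        r < R × Σ (Fin m) λ j → c (turn i r) ≡ just j
                          × margₑ V f x (owned c i r) ≤ᵥ margₑ V f j (owned c i r)
  <deadline⇒dominated {r} {x} r<deadline =
    r<R , greedy-dominates r<R (<deadline⇒addable r<deadline)
    where
    r<R : r < R
    r<R = <-≤-trans r<deadline (deadline≤R x)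

  -- Up to agent i's last turn, taken c t ─ U holds the items other agents took since i's first turn.
  U : Subset m
  U = taken c (toℕ i) ∪ S

  ∣takenByOthers∣≤ : ∀ {r} → r ≤ R → ∣ taken c (turn i r) ─ U ∣ ≤ n′ * r
  ∣takenByOthers∣≤ {zero} _ = ≤-reflexive (trans (Empty⇒∣p∣≡0 empty) (sym (*-zeroʳ n′)))
    where
    empty : Empty (taken c (toℕ i) ─ U)
    empty (_ , x∈) with x∈taken , x∉U ← x∈p─q⁻ (taken c (toℕ i)) U x∈ = x∉U (p⊆p∪q S x∈taken)
  ∣takenByOthers∣≤ {suc r} r<R = begin
    ∣ taken c (turn i (suc r)) ─ U ∣         ≡⟨ cong (λ t → ∣ taken c t ─ U ∣) (turn-suc i r) ⟩
    ∣ taken c (n′ + suc (turn i r)) ─ U ∣    ≤⟨ ∣taken+─∣≤ c U n′ (suc (turn i r)) ⟩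
    n′ + ∣ taken c (suc (turn i r)) ─ U ∣    ≤⟨ +-monoʳ-≤ n′ (p⊆q⇒∣p∣≤∣q∣ ownPick) ⟩
    n′ + ∣ taken c (turn i r) ─ U ∣          ≤⟨ +-monoʳ-≤ n′ (∣takenByOthers∣≤ (<⇒≤ r<R)) ⟩
    n′ + n′ * r                              ≡⟨ *-suc n′ r ⟨
    n′ * suc r                               ∎
    where
    open ≤-Reasoning
    ownPick : taken c (suc (turn i r)) ─ U ⊆ taken c (turn i r) ─ U
    ownPick = addPick─⊆-pickIn (taken c (turn i r)) U (c (turn i r))
                (q⊆p∪q (taken c (toℕ i)) S ∘ owned-mono c i r<R ∘ ∈-addPick (owned c i r))

  module _ {O} (indepO : Indep 𝓘 O) (O⊆available : O ⊆ ∁ (taken c (toℕ i))) where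

    blocked : ℕ → Subset m
    blocked r = filter (λ x → ¬? (𝓘 (owned c i r ∪ ⁅ x ⁆) ≟ᵇ true)) O

    ∣blocked∣≤ : ∀ {p r} → IsPSystem p 𝓘 → r ≤ R → ∣ blocked r ∣ ≤ p * r
    ∣blocked∣≤ {p} {r} pSystem r≤R = begin
      ∣ blocked r ∣          ≤⟨ ∣nonExtendable∣≤p*∣B∣ {p = p} {B = owned c i r} {D = blocked r}
                                  pSystem (owned-indep r≤R) (closed _ _ (filter⊆ _ O) indepO)
                                  (proj₂ ∘ ∈-filter⁻ _ O) ⟩
      p * ∣ owned c i r ∣    ≤⟨ *-monoʳ-≤ p (∣owned∣≤ c i r) ⟩
      p * r                  ∎
      where open ≤-Reasoning

    expired⊆ : ∀ {r} → r < R →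
               filter (λ x → deadline x ≤? r) (O ─ S) ⊆ (taken c (turn i r) ─ U) ∪ blocked r
    expired⊆ {r} r<R {x} x∈ with x∈O─S , deadline≤r ← ∈-filter⁻ _ (O ─ S) x∈
                             with x∈O , x∉S ← x∈p─q⁻ O S x∈O─S
                             with x ∈? taken c (turn i r)
    ... | yes x∈taken = x∈p∪q⁺ (inj₁ (x∈p∧x∉q⇒x∈p─q x∈taken x∉U))
      where
      x∉U : x ∉ U
      x∉U x∈U with x∈p∪q⁻ (taken c (toℕ i)) S x∈U
      ... | inj₁ x∈taken₀ = x∈∁p⇒x∉p (O⊆available x∈O) x∈taken₀
      ... | inj₂ x∈S      = x∉S x∈S
    ... | no x∉taken = x∈p∪q⁺ (inj₂ (∈-filter⁺ _ x∈O λ indep →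
                         <⇒≱ (addable⇒<deadline r<R (x∉taken , indep)) deadline≤r))

    -- In a 0-system only ∅ is independent; for p ≥ 1 the trivial bound m ≤ n R suffices.
    ∣O─S∣≤ : ∀ {p} → IsPSystem p 𝓘 → ∣ O ─ S ∣ ≤ (n′ + p) * R
    ∣O─S∣≤ {zero} pSystem = ≤-trans (∣p─q∣≤∣p∣ O S) (≤-trans ∣O∣≤0 z≤n)
      where
      ∣O∣≤0 : ∣ O ∣ ≤ 0
      ∣O∣≤0 = proj₂ pSystem O O O (indep⇒isBasis indepO) (indep⇒isBasis indepO)
    ∣O─S∣≤ {suc p′} _ = begin
      ∣ O ─ S ∣               ≤⟨ ∣p∣≤n (O ─ S) ⟩
      m                       ≤⟨ m≤rounds*n m n′ ⟩
      R * suc n′              ≡⟨ *-comm R (suc n′) ⟩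
      suc n′ * R              ≤⟨ *-monoˡ-≤ R (s≤s (m≤m+n n′ p′)) ⟩
      suc (n′ + p′) * R       ≡⟨ cong (_* R) (+-suc n′ p′) ⟨
      (n′ + suc p′) * R       ∎
      where open ≤-Reasoning

    hall : ∀ {p} → IsPSystem p 𝓘 → HallCondition (O ─ S) deadline (n′ + p)
    hall {p} pSystem r with r <? R
    ... | yes r<R = begin
      ∣ filter (λ x → deadline x ≤? r) (O ─ S) ∣  ≤⟨ p⊆q⇒∣p∣≤∣q∣ (expired⊆ r<R) ⟩
      ∣ (taken c (turn i r) ─ U) ∪ blocked r ∣    ≤⟨ ∣p∪q∣≤∣p∣+∣q∣ (taken c (turn i r) ─ U) (blocked r) ⟩
      ∣ taken c (turn i r) ─ U ∣ + ∣ blocked r ∣  ≤⟨ +-mono-≤ (∣takenByOthers∣≤ (<⇒≤ r<R))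
                                                              (∣blocked∣≤ {p} pSystem (<⇒≤ r<R)) ⟩
      n′ * r + p * r                              ≡⟨ *-distribʳ-+ r n′ p ⟨
      (n′ + p) * r                                ∎
      where open ≤-Reasoning
    ... | no r≮R = begin
      ∣ filter (λ x → deadline x ≤? r) (O ─ S) ∣  ≤⟨ p⊆q⇒∣p∣≤∣q∣ (filter⊆ (λ x → deadline x ≤? r) (O ─ S)) ⟩
      ∣ O ─ S ∣                                   ≤⟨ ∣O─S∣≤ {p} pSystem ⟩
      (n′ + p) * R                                ≤⟨ *-monoʳ-≤ (n′ + p) (≮⇒≥ r≮R) ⟩
      (n′ + p) * r                                ∎
      where open ≤-Reasoning

∈-preimage⁻ : ∀ {m} {O S : Subset m} {δ : Fin m → ℕ} {r x} →
              x ∈ tabulate (λ y → lookup O y ∧ not (lookup S y) ∧ (δ y ≡ᵇ r)) → x ∈ O ─ S × δ x ≡ r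
∈-preimage⁻ {S = S} {δ} {r} {x} x∈
  with x∈O , rest ← Equivalence.to T-∧ (Equivalence.to (∈-tabulate⇔ _) x∈)
  with x∉S , δx≡r ← Equivalence.to T-∧ rest =
  x∈p∧x∉q⇒x∈p─q (Equivalence.from ∈⇔T-lookup x∈O) x∉S′ , ≡ᵇ⇒≡ (δ x) r δx≡r
  where
  x∉S′ : x ∉ S
  x∉S′ x∈S = subst T (Equivalence.to T-not-≡ x∉S) (Equivalence.to ∈⇔T-lookup x∈S)

lemma1 : (V : OrderedAbelianGroup) → (n m : ℕ) → (i : Fin n)
    → (f : Subset m → OrderedAbelianGroup.Carrier V) → (𝓘 : Family m) → (p : ℕ)
    → Normalized V f → NonNegative V f → Monotone V f → Submodular V f
    → IsPSystem p 𝓘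
    → (c : Choices m) → ValidRun n c → Greedy V n i f 𝓘 c
    → (O : Subset m) → Indep 𝓘 O → O ⊆ ∁ (taken c (toℕ i))
    → (∀ T → Indep 𝓘 T → T ⊆ ∁ (taken c (toℕ i)) → OrderedAbelianGroup._≤ᵥ_ V (f T) (f O))
    → Σ (Fin m → ℕ) λ δ →
        (∀ x → x ∈ O → x ∉ owned c i (rounds m n) →
           (δ x < rounds m n) × Σ (Fin m) λ j → (c (turn i (δ x)) ≡ just j)
             × OrderedAbelianGroup._≤ᵥ_ V (margₑ V f x (owned c i (δ x))) (margₑ V f j (owned c i (δ x))))
        × (∀ r j → r < rounds m n → c (turn i r) ≡ just j →
             preimageSize O (owned c i (rounds m n)) δ r ≤ n + p ∸ 1)
lemma1 V zero     _ () _ _ _ _ _ _ _ _ _ _ _ _ _ _ _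
lemma1 V (suc n′) m i  f 𝓘 p _ _ _ _ pSystem c _ greedy O indepO O⊆available _ =
    slot
  , (λ x x∈O x∉S → <deadline⇒dominated (slot<deadline (x∈p∧x∉q⇒x∈p─q x∈O x∉S)))
  , (λ r _ _ _ → load≤capacity r (∈-preimage⁻ {δ = slot}))
  where
  open GreedyRun V i f 𝓘 (proj₁ pSystem) c greedy
  open Schedule (hall⇒schedule (O ─ S) deadline (n′ + p) (hall indepO O⊆available {p} pSystem))
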